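{- Consider an SDSP instance. Let $S=\{k_1,\dots,k_l\}\subseteq\mathcal{N}$ consist of $l$ deliveries of largest density, listed so that $d_{k_1}\ge\dots\ge d_{k_l}$ and $d_{k_l}\ge d_j$ for every $j\notin S$, and suppose $S$ is compatible and critical. Then $\max\big(\mathcal{P}(\{k_l\}),\,\mathcal{P}(S\setminus\{k_l\})\big)\ge \tfrac12 f(1)$.
   Context: An SDSP instance consists of deliveries $\mathcal{N}=\{1,\dots,n\}$ and one drone with battery budget $B>0$. Each delivery $j$ has a closed time interval $I_j=[t_j^L,t_j^R]$, a cost $c_j>0$ and a profit $p_j\ge0$; its density is $d_j=p_j/c_j$. Deliveries $j\ne k$ are compatible if $I_j\cap I_k=\emptyset$. A set is compatible if its elements are pairwise compatible and feasible if also $\mathcal{W}(S)=\sum_{j\in S}c_j\le B$; $\mathcal{P}(S)=\sum_{j\in S}p_j$. $f(1)$ is the maximum profit of a feasible set. The set $S=\{k_1,\dots,k_l\}$ with $d_{k_1}\ge\dots\ge d_{k_l}$ is critical if $\mathcal{W}(S)>B$ and $\mathcal{W}(S\setminus\{k_l\})\le B$.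
   Formalization: The interval endpoints $t_j^L$ and $t_j^R$, the costs $c_j$, the profits $p_j$ and the budget $B$ of the SDSP instance are rational. -}

module Defs where

open import Data.Nat using (ℕ; zero; suc)
open import Data.Fin using (Fin; zero; suc)
open import Data.Fin.Subset using (Subset; _∈_; _─_; ⁅_⁆)
open import Data.Vec using (lookup)
open import Data.Bool using (if_then_else_)
open import Data.Product using (Σ; ∃; _×_)
open import Data.Rational using (ℚ; 0ℚ; _+_; _÷_; _≤_; _<_; Positive)
open import Data.Rational.Properties using (pos⇒nonZero)
open import Relation.Binary.PropositionalEquality using (_≡_; _≢_)
open import Relation.Nullary using (¬_)

sumFin : (n : ℕ) → (Fin n → ℚ) → ℚ
sumFin zero    f = 0ℚ
sumFin (suc n) f = f zero + sumFin n (λ j → f (suc j))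

-- An SDSP instance with n deliveries (indexed by Fin n) and one drone.
record SDSP (n : ℕ) : Set where
  field
    B     : ℚ
    B-pos : 0ℚ < B
    tL tR : Fin n → ℚ
    tL≤tR : ∀ j → tL j ≤ tR j
    c     : Fin n → ℚ
    c-pos : ∀ j → Positive (c j)
    p     : Fin n → ℚ
    p-nonneg : ∀ j → 0ℚ ≤ p j

module _ {n : ℕ} (I : SDSP n) where
  open SDSP I

  density : Fin n → ℚ
  density j = _÷_ (p j) (c j) {{pos⇒nonZero (c j) {{c-pos j}}}}

  InInterval : ℚ → Fin n → Set
  InInterval t j = (tL j ≤ t) × (t ≤ tR j)

  Compatible : Fin n → Fin n → Set
  Compatible j k = ¬ (∃ λ t → InInterval t j × InInterval t k)

  CompatibleSet : Subset n → Set
  CompatibleSet S = ∀ j k → j ∈ S → k ∈ S → j ≢ k → Compatible j k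

  W : Subset n → ℚ
  W S = sumFin n (λ j → if lookup S j then c j else 0ℚ)

  P : Subset n → ℚ
  P S = sumFin n (λ j → if lookup S j then p j else 0ℚ)

  Feasible : Subset n → Set
  Feasible S = CompatibleSet S × (W S ≤ B)

  -- v is f(1): the maximum profit of a feasible set
  IsOptimalValue : ℚ → Set
  IsOptimalValue v = (Σ (Subset n) λ T → Feasible T × (P T ≡ v))
                   × (∀ T → Feasible T → P T ≤ v)

{-# OPTIONS --safe #-}
-- Let δ = d_{k_l}. Every delivery of S has density at least δ and every other delivery at most δ,
-- so exchanging items between any set T and S changes profit by at most δ per unit of cost:
-- P(T) + δ W(S) ≤ P(S) + δ W(T). An optimal set weighs at most B < W(S), hence f(1) ≤ P(S),
-- and P(S) = P({k_l}) + P(S ∖ {k_l}) is at most twice the larger summand.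
module Submission where

open import Defs
open import Data.Nat using (ℕ; suc)
open import Data.Fin using (Fin; fromℕ; _≤_)
open import Data.Fin.Subset using (Subset; _∈_; _∉_; _─_; ⁅_⁆)
open import Data.Product using (∃; _×_)
open import Data.Rational using (ℚ; ½; _*_; _⊔_; _<_) renaming (_≤_ to _≤ℚ_)
open import Relation.Binary.PropositionalEquality using (_≡_)
open import Function.Definitions using (Injective)

open import Algebra.Bundles using (CommutativeRing)
open import Data.Bool using (true; false; if_then_else_; _∧_; not)
open import Data.Bool.Properties using (∧-zeroʳ; ∧-identityʳ)
open import Data.Fin using (zero; suc)
open import Data.Fin.Properties using (≤fromℕ)
open import Data.Fin.Subset using (_⊆_)
open import Data.Fin.Subset.Properties using (x∈⁅y⁆⇒x≡y)
open import Data.Product using (_,_)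
open import Data.Rational using (0ℚ; 1ℚ; _+_; -_; 1/_; NonNegative; NonZero; nonNegative)
open import Data.Rational.Properties
open import Data.Vec using (lookup; _∷_)
open import Data.Vec.Properties using (lookup⇒[]=; []=⇒lookup)
open import Relation.Binary.PropositionalEquality using (refl; sym; trans; cong; cong₂; subst; module ≡-Reasoning)

open import Algebra.Properties.Group +-0-group using (//-rightDividesʳ)
open import Algebra.Properties.Semiring.Sum (CommutativeRing.semiring +-*-commutativeRing)
  using (sum; ∑-distrib-+; *-distribˡ-sum)

sumFin≡sum : ∀ n (f : Fin n → ℚ) → sumFin n f ≡ sum f
sumFin≡sum 0       f = refl
sumFin≡sum (suc n) f = cong (f zero +_) (sumFin≡sum n (λ j → f (suc j)))

sumFin-distrib-+ : ∀ n (f g : Fin n → ℚ) → sumFin n (λ j → f j + g j) ≡ sumFin n f + sumFin n g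
sumFin-distrib-+ n f g = begin
  sumFin n (λ j → f j + g j)  ≡⟨ sumFin≡sum n _ ⟩
  sum (λ j → f j + g j)       ≡⟨ ∑-distrib-+ f g ⟩
  sum f + sum g               ≡⟨ cong₂ _+_ (sumFin≡sum n f) (sumFin≡sum n g) ⟨
  sumFin n f + sumFin n g     ∎
  where open ≡-Reasoning

sumFin-distribˡ-* : ∀ n x (f : Fin n → ℚ) → sumFin n (λ j → x * f j) ≡ x * sumFin n f
sumFin-distribˡ-* n x f = begin
  sumFin n (λ j → x * f j)  ≡⟨ sumFin≡sum n _ ⟩
  sum (λ j → x * f j)       ≡⟨ *-distribˡ-sum x f ⟨
  x * sum f                 ≡⟨ cong (x *_) (sumFin≡sum n f) ⟨
  x * sumFin n f            ∎
  where open ≡-Reasoning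

sumFin-cong : ∀ n {f g : Fin n → ℚ} → (∀ j → f j ≡ g j) → sumFin n f ≡ sumFin n g
sumFin-cong 0       f≗g = refl
sumFin-cong (suc n) f≗g = cong₂ _+_ (f≗g zero) (sumFin-cong n (λ j → f≗g (suc j)))

sumFin-mono-≤ : ∀ n {f g : Fin n → ℚ} → (∀ j → f j ≤ℚ g j) → sumFin n f ≤ℚ sumFin n g
sumFin-mono-≤ 0       f≤g = ≤-refl
sumFin-mono-≤ (suc n) f≤g = +-mono-≤ (f≤g zero) (sumFin-mono-≤ n (λ j → f≤g (suc j)))

+-cancelʳ-≤ : ∀ x {a b} → a + x ≤ℚ b + x → a ≤ℚ b
+-cancelʳ-≤ x {a} {b} a+x≤b+x = begin
  a              ≡⟨ //-rightDividesʳ x a ⟨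
  a + x + - x    ≤⟨ +-monoˡ-≤ (- x) a+x≤b+x ⟩
  b + x + - x    ≡⟨ //-rightDividesʳ x b ⟩
  b              ∎
  where open ≤-Reasoning

½*[p+q]≤p⊔q : ∀ p q → ½ * (p + q) ≤ℚ p ⊔ q
½*[p+q]≤p⊔q p q = begin
  ½ * (p + q)      ≤⟨ *-monoˡ-≤-nonNeg ½ (+-mono-≤ (p≤p⊔q p q) (p≤q⊔p p q)) ⟩
  ½ * (m + m)      ≡⟨ *-distribˡ-+ ½ m m ⟩
  ½ * m + ½ * m    ≡⟨ *-distribʳ-+ m ½ ½ ⟨
  (½ + ½) * m      ≡⟨ *-identityˡ m ⟩
  m                ∎
  where
  open ≤-Reasoning
  m = p ⊔ q

lookup≡false⇒∉ : ∀ {n} {S : Subset n} {j} → lookup S j ≡ false → j ∉ S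
lookup≡false⇒∉ S[j]≡false j∈S with () ← trans (sym ([]=⇒lookup j∈S)) S[j]≡false

lookup-─ : ∀ {n} (S Q : Subset n) j → lookup (S ─ Q) j ≡ lookup S j ∧ not (lookup Q j)
lookup-─ (s ∷ _) (true  ∷ _) zero    = sym (∧-zeroʳ s)
lookup-─ (s ∷ _) (false ∷ _) zero    = sym (∧-identityʳ s)
lookup-─ (_ ∷ S) (_ ∷ Q)     (suc j) = lookup-─ S Q j

restrict : ∀ {n} → Subset n → (Fin n → ℚ) → Fin n → ℚ
restrict S f j = if lookup S j then f j else 0ℚ

-- W and P of an SDSP instance are definitionally sums of this form.
sumOver : ∀ {n} → Subset n → (Fin n → ℚ) → ℚ
sumOver {n} S f = sumFin n (restrict S f)

sumOver-split : ∀ {n} (f : Fin n → ℚ) {Q S : Subset n} → Q ⊆ S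
  → sumOver S f ≡ sumOver Q f + sumOver (S ─ Q) f
sumOver-split {n} f {Q} {S} Q⊆S =
  trans (sumFin-cong n split-at) (sumFin-distrib-+ n (restrict Q f) (restrict (S ─ Q) f))
  where
  split-at : ∀ j → restrict S f j ≡ restrict Q f j + restrict (S ─ Q) f j
  split-at j rewrite lookup-─ S Q j with lookup S j in S[j] | lookup Q j in Q[j]
  ... | true  | true  = sym (+-identityʳ (f j))
  ... | true  | false = sym (+-identityˡ (f j))
  ... | false | false = sym (+-identityˡ 0ℚ)
  ... | false | true  with () ← trans (sym S[j]) ([]=⇒lookup (Q⊆S (lookup⇒[]= j Q Q[j])))

threshold-set-dominates : ∀ {n} (p c : Fin n → ℚ) (δ : ℚ) .{{_ : NonNegative δ}} (S T : Subset n)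
  → (∀ j → j ∈ S → δ * c j ≤ℚ p j)
  → (∀ j → j ∉ S → p j ≤ℚ δ * c j)
  → sumOver T c ≤ℚ sumOver S c
  → sumOver T p ≤ℚ sumOver S p
threshold-set-dominates {n} p c δ S T dense sparse W[T]≤W[S] =
  +-cancelʳ-≤ (δ * sumOver S c) (begin
    sumOver T p + δ * sumOver S c  ≡⟨ expand T S ⟨
    sumFin n (term T S)            ≤⟨ sumFin-mono-≤ n exchange-at ⟩
    sumFin n (term S T)            ≡⟨ expand S T ⟩
    sumOver S p + δ * sumOver T c  ≤⟨ +-monoʳ-≤ (sumOver S p) (*-monoˡ-≤-nonNeg δ W[T]≤W[S]) ⟩
    sumOver S p + δ * sumOver S c  ∎)
  where
  open ≤-Reasoning

  term : Subset n → Subset n → Fin n → ℚ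
  term A C j = restrict A p j + δ * restrict C c j

  expand : ∀ A C → sumFin n (term A C) ≡ sumOver A p + δ * sumOver C c
  expand A C = trans (sumFin-distrib-+ n (restrict A p) (λ j → δ * restrict C c j))
    (cong (sumOver A p +_) (sumFin-distribˡ-* n δ (restrict C c)))

  exchange : ∀ {x y} t s → (s ≡ true → δ * y ≤ℚ x) → (s ≡ false → x ≤ℚ δ * y)
    → (if t then x else 0ℚ) + δ * (if s then y else 0ℚ) ≤ℚ (if s then x else 0ℚ) + δ * (if t then y else 0ℚ)
  exchange         true  true  _    _      = ≤-refl
  exchange         false false _    _      = ≤-refl
  exchange {x} {y} true  false _    x≤δy rewrite *-zeroʳ δ | +-identityʳ x | +-identityˡ (δ * y) = x≤δy refl
  exchange {x} {y} false true  δy≤x _    rewrite *-zeroʳ δ | +-identityʳ x | +-identityˡ (δ * y) = δy≤x refl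

  exchange-at : ∀ j → term T S j ≤ℚ term S T j
  exchange-at j = exchange (lookup T j) (lookup S j)
    (λ S[j] → dense j (lookup⇒[]= j S S[j]))
    (λ S[j] → sparse j (lookup≡false⇒∉ S[j]))

module _ {n : ℕ} (I : SDSP n) where
  open SDSP I

  private instance
    c-nonZero : ∀ {j} → NonZero (c j)
    c-nonZero {j} = pos⇒nonZero (c j) {{c-pos j}}

    c-nonNeg : ∀ {j} → NonNegative (c j)
    c-nonNeg {j} = pos⇒nonNeg (c j) {{c-pos j}}

  density-nonNeg : ∀ j → NonNegative (density I j)
  density-nonNeg j = nonNeg*nonNeg⇒nonNeg (p j) {{nonNegative (p-nonneg j)}} (1/ c j)
    {{pos⇒nonNeg (1/ c j) {{1/pos⇒pos (c j) {{c-pos j}}}}}}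

  density*cost≡profit : ∀ j → density I j * c j ≡ p j
  density*cost≡profit j = begin
    p j * 1/ c j * c j    ≡⟨ *-assoc (p j) (1/ c j) (c j) ⟩
    p j * (1/ c j * c j)  ≡⟨ cong (p j *_) (*-inverseˡ (c j)) ⟩
    p j * 1ℚ              ≡⟨ *-identityʳ (p j) ⟩
    p j                   ∎
    where open ≡-Reasoning

  ≤density⇒*cost≤profit : ∀ {δ} j → δ ≤ℚ density I j → δ * c j ≤ℚ p j
  ≤density⇒*cost≤profit j δ≤d = subst (_ ≤ℚ_) (density*cost≡profit j)
    (*-monoʳ-≤-nonNeg (c j) δ≤d)

  density≤⇒profit≤*cost : ∀ {δ} j → density I j ≤ℚ δ → p j ≤ℚ δ * c j
  density≤⇒profit≤*cost j d≤δ = subst (_≤ℚ _) (density*cost≡profit j)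
    (*-monoʳ-≤-nonNeg (c j) d≤δ)

  optimalValue≤P : ∀ {f1} (S : Subset n) (δ : ℚ) .{{_ : NonNegative δ}}
    → (∀ j → j ∈ S → δ ≤ℚ density I j)
    → (∀ j → j ∉ S → density I j ≤ℚ δ)
    → B < W I S
    → IsOptimalValue I f1
    → f1 ≤ℚ P I S
  optimalValue≤P S δ dense sparse B<W[S] ((T , (_ , W[T]≤B) , P[T]≡f1) , _) =
    subst (_≤ℚ P I S) P[T]≡f1
      (threshold-set-dominates p c δ S T
        (λ j j∈S → ≤density⇒*cost≤profit j (dense j j∈S))
        (λ j j∉S → density≤⇒profit≤*cost j (sparse j j∉S))
        (≤-trans W[T]≤B (<⇒≤ B<W[S])))

corollary1 : ∀ {n : ℕ} (I : SDSP n) (m : ℕ) (k : Fin (suc m) → Fin n) (S : Subset n)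
    → Injective _≡_ _≡_ k
    → (∀ j → j ∈ S → ∃ λ i → k i ≡ j)
    → (∀ i → k i ∈ S)
    → (∀ i i′ → i ≤ i′ → density I (k i′) ≤ℚ density I (k i))
    → (∀ j → j ∉ S → density I j ≤ℚ density I (k (fromℕ m)))
    → CompatibleSet I S
    → SDSP.B I < W I S
    → W I (S ─ ⁅ k (fromℕ m) ⁆) ≤ℚ SDSP.B I
    → ∀ (f1 : ℚ) → IsOptimalValue I f1
    → ½ * f1 ≤ℚ (P I ⁅ k (fromℕ m) ⁆ ⊔ P I (S ─ ⁅ k (fromℕ m) ⁆))
corollary1 I m k S _ S⊆range[k] k∈S sorted below _ B<W[S] _ f1 opt = begin
  ½ * f1                               ≤⟨ *-monoˡ-≤-nonNeg ½ f1≤P[S] ⟩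
  ½ * P I S                            ≡⟨ cong (½ *_) (sumOver-split (SDSP.p I) ⁅kₗ⁆⊆S) ⟩
  ½ * (P I ⁅ kₗ ⁆ + P I (S ─ ⁅ kₗ ⁆))  ≤⟨ ½*[p+q]≤p⊔q (P I ⁅ kₗ ⁆) (P I (S ─ ⁅ kₗ ⁆)) ⟩
  P I ⁅ kₗ ⁆ ⊔ P I (S ─ ⁅ kₗ ⁆)         ∎
  where
  open ≤-Reasoning
  kₗ = k (fromℕ m)

  ⁅kₗ⁆⊆S : ⁅ kₗ ⁆ ⊆ S
  ⁅kₗ⁆⊆S j∈⁅kₗ⁆ = subst (_∈ S) (sym (x∈⁅y⁆⇒x≡y kₗ j∈⁅kₗ⁆)) (k∈S (fromℕ m))

  above : ∀ j → j ∈ S → density I kₗ ≤ℚ density I j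
  above j j∈S with S⊆range[k] j j∈S
  ... | i , refl = sorted i (fromℕ m) (≤fromℕ i)

  f1≤P[S] : f1 ≤ℚ P I S
  f1≤P[S] = optimalValue≤P I S (density I kₗ) {{density-nonNeg I kₗ}} above below B<W[S] opt
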